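{- Let $G$ be a finite, simple, connected graph of order $n\ge 4$. Let $u,w_1,w_2\in V(G)$ be such that $\deg(u)=n-3$ and $V(G)=N[u]\cup\{w_1,w_2\}$. Then $\{u\}$ is a power dominating set of minimum cardinality (i.e. $\{u\}$ is a power dominating set) if and only if $w_1$ and $w_2$ are not twins.
   Context: Two vertices $x,y$ are twins if $N(x)=N(y)$ or $N[x]=N[y]$. Zero forcing: for $U\subseteq V(G)$ (black vertices), repeatedly apply the rule "if a black vertex has exactly one white neighbor, that neighbor becomes black"; the resulting set is the closure $cl(U)$. A set $S$ is a power dominating set if $cl(N[S])=V(G)$, where $N[S]$ is the closed neighborhood of $S$. -}

module Defs where

open import Data.Nat using (ℕ; zero; suc; _∸_)
open import Data.Fin using (Fin)
open import Data.Bool using (Bool; true; false; T)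
open import Data.List using (List; allFin; filter; length)
open import Data.Sum using (_⊎_)
open import Data.Product using (_×_; Σ; ∃)
open import Data.Empty using (⊥)
open import Relation.Nullary using (¬_)
open import Relation.Nullary.Decidable using (T?)
open import Relation.Binary.PropositionalEquality using (_≡_)
open import Function.Bundles using (_⇔_)

record Graph (n : ℕ) : Set where
  field
    adj   : Fin n → Fin n → Bool
    sym   : ∀ x y → adj x y ≡ adj y x
    irefl : ∀ x → adj x x ≡ false

module _ {n : ℕ} (G : Graph n) where
  open Graph G

  Adj : Fin n → Fin n → Set
  Adj x y = T (adj x y)

  data Walk : Fin n → Fin n → Set where
    here : ∀ {x} → Walk x x
    step : ∀ {x y z} → Adj x y → Walk y z → Walk x z

  Connected : Set
  Connected = ∀ x y → Walk x y

  deg : Fin n → ℕ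
  deg x = length (filter (λ y → T? (adj x y)) (allFin n))

  ClosedNbhd : Fin n → Fin n → Set
  ClosedNbhd x v = v ≡ x ⊎ Adj x v

  Twins : Fin n → Fin n → Set
  Twins x y = (∀ z → Adj x z ⇔ Adj y z) ⊎ (∀ z → ClosedNbhd x z ⇔ ClosedNbhd y z)

  -- Zero forcing closure cl(U), as the least set containing U and closed
  -- under the colour-change rule: if b is black and v is the only white
  -- neighbour of b (all other neighbours of b are black), then v is black.
  data InCl (U : Fin n → Set) : Fin n → Set where
    base  : ∀ {v} → U v → InCl U v
    force : ∀ {b v} → InCl U b → Adj b v →
            (∀ w → Adj b w → ¬ (w ≡ v) → InCl U w) → InCl U v

  ClosedNbhdSet : (Fin n → Set) → Fin n → Set
  ClosedNbhdSet S v = ∃ λ s → S s × ClosedNbhd s v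

  PowerDominating : (Fin n → Set) → Set
  PowerDominating S = ∀ v → InCl (ClosedNbhdSet S) v

-- Counting shows that w₁ and w₂ are distinct and lie outside N[u], so they are the
-- only vertices not coloured initially. A vertex outside {w₁, w₂} adjacent to one
-- twin is adjacent to the other, so it never forces either of them: twins stay
-- white. Otherwise some z ∈ N[u] is adjacent to exactly one of them; z forces
-- it, after which the other is the only white vertex and any neighbour forces it.
module Submission where

open import Defs
open import Data.Nat using (ℕ; _+_; _≥_; _∸_; _≤_; _<_; s≤s)
open import Data.Nat.Properties using (n<1+n; <⇒≤; ≤⇒≯)
open import Data.Fin using (Fin; _≟_)
open import Data.Fin.Properties using (any?; injective⇒≤)
open import Data.Bool using (T)
open import Data.List using (List; _∷_; length; filter; allFin; lookup)
open import Data.List.Membership.Propositional using (_∈_)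
open import Data.List.Membership.Propositional.Properties using (∈-filter⁺; ∈-allFin)
open import Data.List.Relation.Unary.Any using (here; there; index)
open import Data.List.Relation.Unary.Any.Properties using (lookup-index)
open import Data.Sum using (_⊎_; inj₁; inj₂; [_,_]′; map₁; map₂; swap)
open import Data.Product using (_×_; _,_; ∃)
open import Data.Empty using (⊥-elim)
open import Function using (_∘_; id)
open import Function.Bundles using (_⇔_; mk⇔; Equivalence)
open import Function.Properties.Equivalence using () renaming (sym to ⇔-sym)
open import Relation.Unary using (Decidable)
open import Relation.Nullary using (¬_; yes; no; ¬?; contradiction)
open import Relation.Nullary.Decidable using (T?; _×-dec_; decidable-stable)
open import Relation.Binary.PropositionalEquality
  using (_≡_; _≢_; refl; sym; cong; subst; ≢-sym; module ≡-Reasoning)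

covering-list-length : ∀ {n} (xs : List (Fin n)) → (∀ v → v ∈ xs) → n ≤ length xs
covering-list-length xs cover = injective⇒≤ position-injective
  where
    position-injective : ∀ {i j} → index (cover i) ≡ index (cover j) → i ≡ j
    position-injective {i} {j} same-position = begin
      i                             ≡⟨ lookup-index (cover i) ⟩
      lookup xs (index (cover i))   ≡⟨ cong (lookup xs) same-position ⟩
      lookup xs (index (cover j))   ≡⟨ sym (lookup-index (cover j)) ⟩
      j                             ∎
      where open ≡-Reasoning

2+[n∸3]<n : ∀ {n} → n ≥ 3 → 2 + (n ∸ 3) < n
2+[n∸3]<n (s≤s (s≤s (s≤s _))) = n<1+n _

cover-absorb : ∀ {A : Set} {C : A → Set} {a b : A} → C a ⊎ a ≡ b →
  (∀ v → C v ⊎ v ≡ a ⊎ v ≡ b) → ∀ v → C v ⊎ v ≡ b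
cover-absorb a∈C∪b cover v with cover v
... | inj₁ v∈C        = inj₁ v∈C
... | inj₂ (inj₁ refl) = a∈C∪b
... | inj₂ (inj₂ v≡b) = inj₂ v≡b

module _ {n : ℕ} (G : Graph n) where
  open Graph G renaming (sym to adj-symmetric)

  adj-sym : ∀ {x y} → Adj G x y → Adj G y x
  adj-sym {x} {y} = subst T (adj-symmetric x y)

  adj⇒≢ : ∀ {x y} → Adj G x y → x ≢ y
  adj⇒≢ {x} x~y refl = subst T (irefl x) x~y

  first-step : ∀ {x y} → Walk G x y → x ≢ y → ∃ (Adj G x)
  first-step here          x≢x = ⊥-elim (x≢x refl)
  first-step (step x~z _)  _   = _ , x~z

  closedNbhd∪one-bound : ∀ u x → (∀ v → ClosedNbhd G u v ⊎ v ≡ x) → n ≤ 2 + deg G u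
  closedNbhd∪one-bound u x cover =
    covering-list-length (u ∷ x ∷ filter (T? ∘ adj u) (allFin n)) listed
    where
      listed : ∀ v → v ∈ u ∷ x ∷ filter (T? ∘ adj u) (allFin n)
      listed v with cover v
      ... | inj₁ (inj₁ refl) = here refl
      ... | inj₁ (inj₂ u~v)  = there (there (∈-filter⁺ (T? ∘ adj u) (∈-allFin v) u~v))
      ... | inj₂ refl        = there (here refl)

  twins-sym : ∀ {x y} → Twins G x y → Twins G y x
  twins-sym (inj₁ open-twins)   = inj₁ (⇔-sym ∘ open-twins)
  twins-sym (inj₂ closed-twins) = inj₂ (⇔-sym ∘ closed-twins)

  twins⇒adj : ∀ {x y z} → Twins G x y → z ≢ y → Adj G z x → Adj G z y
  twins⇒adj {z = z} (inj₁ open-twins) _ z~x =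
    adj-sym (Equivalence.to (open-twins z) (adj-sym z~x))
  twins⇒adj {z = z} (inj₂ closed-twins) z≢y z~x =
    [ ⊥-elim ∘ z≢y , adj-sym ]′ (Equivalence.to (closed-twins z) (inj₂ (adj-sym z~x)))

  Distinguishes : Fin n → Fin n → Fin n → Set
  Distinguishes z x y = z ≢ y × Adj G z x × ¬ Adj G z y

  distinguishes? : ∀ x y → Decidable (λ z → Distinguishes z x y)
  distinguishes? x y z = ¬? (z ≟ y) ×-dec T? (adj z x) ×-dec ¬? (T? (adj z y))

  module _ {x y : Fin n} (undistinguished : ¬ ∃ λ z → Distinguishes z x y) where

    undistinguished⇒adj : ∀ {z} → z ≢ y → Adj G z x → Adj G z y
    undistinguished⇒adj {z} z≢y z~x =
      decidable-stable (T? (adj z y)) (λ z≁y → undistinguished (z , z≢y , z~x , z≁y))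

    nbhd-⊆ : ¬ Adj G x y → ∀ {z} → Adj G x z → Adj G y z
    nbhd-⊆ x≁y x~z =
      adj-sym (undistinguished⇒adj (λ z≡y → x≁y (subst (Adj G x) z≡y x~z)) (adj-sym x~z))

    closedNbhd-⊆ : Adj G x y → ∀ {z} → ClosedNbhd G x z → ClosedNbhd G y z
    closedNbhd-⊆ x~y (inj₁ refl) = inj₂ (adj-sym x~y)
    closedNbhd-⊆ x~y {z} (inj₂ x~z) with z ≟ y
    ... | yes z≡y = inj₁ z≡y
    ... | no  z≢y = inj₂ (adj-sym (undistinguished⇒adj z≢y (adj-sym x~z)))

  undistinguished⇒twins : ∀ {x y} → ¬ ∃ (λ z → Distinguishes z x y) →
    ¬ ∃ (λ z → Distinguishes z y x) → Twins G x y
  undistinguished⇒twins {x} {y} ¬dxy ¬dyx with T? (adj x y)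
  ... | no  x≁y = inj₁ λ z → mk⇔ (nbhd-⊆ ¬dxy x≁y) (nbhd-⊆ ¬dyx (x≁y ∘ adj-sym))
  ... | yes x~y = inj₂ λ z → mk⇔ (closedNbhd-⊆ ¬dxy x~y) (closedNbhd-⊆ ¬dyx (adj-sym x~y))

  ¬twins⇒distinguisher : ∀ {x y} → ¬ Twins G x y →
    (∃ λ z → Distinguishes z x y) ⊎ (∃ λ z → Distinguishes z y x)
  ¬twins⇒distinguisher {x} {y} ¬twins with any? (distinguishes? x y) | any? (distinguishes? y x)
  ... | yes dxy | _       = inj₁ dxy
  ... | no  _   | yes dyx = inj₂ dyx
  ... | no ¬dxy | no ¬dyx = contradiction (undistinguished⇒twins ¬dxy ¬dyx) ¬twins

  twin∉closure : ∀ {U : Fin n → Set} {x y} → Twins G x y → x ≢ y →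
    (∀ {v} → U v → v ≢ x) → (∀ {v} → U v → v ≢ y) → ∀ {v} → InCl G U v → v ≢ x
  twin∉closure tw x≢y U∌x U∌y (base Uv) = U∌x Uv
  twin∉closure {y = y} tw x≢y U∌x U∌y (force {b} black-b b~x others-black) refl =
    twin∉closure (twins-sym tw) (≢-sym x≢y) U∌y U∌x
      (others-black y (twins⇒adj tw b≢y b~x) (≢-sym x≢y)) refl
    where
      b≢y : b ≢ y
      b≢y = twin∉closure (twins-sym tw) (≢-sym x≢y) U∌y U∌x black-b

  closure-all-but-one : ∀ {U : Fin n → Set} {b x} → Connected G → x ≢ b →
    (∀ v → v ≢ b → InCl G U v) → ∀ v → InCl G U v
  closure-all-but-one {b = b} {x} connected x≢b all-but-b v with v ≟ b
  ... | no  v≢b  = all-but-b v v≢b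
  ... | yes refl with first-step (connected b x) (≢-sym x≢b)
  ...   | y , b~y = force (all-but-b y (≢-sym (adj⇒≢ b~y))) (adj-sym b~y)
                      (λ w _ w≢b → all-but-b w w≢b)

  distinguisher⇒powerDominating : ∀ {u a b z} → Connected G →
    (∀ v → ClosedNbhd G u v ⊎ v ≡ a ⊎ v ≡ b) → ¬ ClosedNbhd G u b →
    Distinguishes z a b → PowerDominating G (_≡ u)
  distinguisher⇒powerDominating {u} {a} {b} {z} connected cover b∉N[u] (z≢b , z~a , z≁b) =
    closure-all-but-one connected (λ u≡b → b∉N[u] (inj₁ (sym u≡b))) all-but-b
    where
      U : Fin n → Set
      U = ClosedNbhdSet G (_≡ u)

      black-or-a-or-b : ∀ v → InCl G U v ⊎ v ≡ a ⊎ v ≡ b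
      black-or-a-or-b v = map₁ (λ v∈N[u] → base (u , refl , v∈N[u])) (cover v)

      black-unless-a : ∀ v → v ≢ b → InCl G U v ⊎ v ≡ a
      black-unless-a v v≢b = [ inj₁ , [ inj₂ , ⊥-elim ∘ v≢b ]′ ]′ (black-or-a-or-b v)

      black-a : InCl G U a
      black-a = force black-z z~a λ w z~w w≢a →
        [ id , ⊥-elim ∘ w≢a ]′ (black-unless-a w (λ w≡b → z≁b (subst (Adj G z) w≡b z~w)))
        where
          black-z : InCl G U z
          black-z = [ id , ⊥-elim ∘ adj⇒≢ z~a ]′ (black-unless-a z z≢b)

      all-but-b : ∀ v → v ≢ b → InCl G U v
      all-but-b v v≢b = [ id , (λ { refl → black-a }) ]′ (black-unless-a v v≢b)

mainTheorem6 : (n : ℕ) → n ≥ 4 → (G : Graph n) → Connected G →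
    (u w₁ w₂ : Fin n) → deg G u ≡ n ∸ 3 →
    (∀ v → ClosedNbhd G u v ⊎ v ≡ w₁ ⊎ v ≡ w₂) →
    PowerDominating G (λ x → x ≡ u) ⇔ (¬ Twins G w₁ w₂)
mainTheorem6 n n≥4 G connected u w₁ w₂ deg-u cover = mk⇔ pd⇒¬twins ¬twins⇒pd
  where
    cover-swapped : ∀ v → ClosedNbhd G u v ⊎ v ≡ w₂ ⊎ v ≡ w₁
    cover-swapped = map₂ swap ∘ cover

    N[u]∪one-too-small : ∀ {x} → ¬ (∀ v → ClosedNbhd G u v ⊎ v ≡ x)
    N[u]∪one-too-small {x} covered = ≤⇒≯ (closedNbhd∪one-bound G u x covered)
      (subst (λ d → 2 + d < n) (sym deg-u) (2+[n∸3]<n (<⇒≤ n≥4)))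

    w₁∉N[u] : ¬ ClosedNbhd G u w₁
    w₁∉N[u] w₁∈N[u] = N[u]∪one-too-small (cover-absorb (inj₁ w₁∈N[u]) cover)

    w₂∉N[u] : ¬ ClosedNbhd G u w₂
    w₂∉N[u] w₂∈N[u] = N[u]∪one-too-small (cover-absorb (inj₁ w₂∈N[u]) cover-swapped)

    w₁≢w₂ : w₁ ≢ w₂
    w₁≢w₂ w₁≡w₂ = N[u]∪one-too-small (cover-absorb (inj₂ w₁≡w₂) cover)

    pd⇒¬twins : PowerDominating G (_≡ u) → ¬ Twins G w₁ w₂
    pd⇒¬twins pd twins = twin∉closure G twins w₁≢w₂
      (λ { (_ , refl , w₁∈N[u]) refl → w₁∉N[u] w₁∈N[u] })
      (λ { (_ , refl , w₂∈N[u]) refl → w₂∉N[u] w₂∈N[u] }) (pd w₁) refl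

    ¬twins⇒pd : ¬ Twins G w₁ w₂ → PowerDominating G (_≡ u)
    ¬twins⇒pd ¬twins with ¬twins⇒distinguisher G ¬twins
    ... | inj₁ (_ , d) = distinguisher⇒powerDominating G connected cover w₂∉N[u] d
    ... | inj₂ (_ , d) = distinguisher⇒powerDominating G connected cover-swapped w₁∉N[u] d
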